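{- For each positive integer $n$, let $W_{n,n}$ be the set of lattice walks from $(0,0)$ to $(n,n)$ using unit steps right $(1,0)$ and up $(0,1)$, and let $X_n = a_1(w)$ where $w$ is chosen uniformly at random from $W_{n,n}$ and $a_1$ is the number of losing times defined below. Then $\mathbb{E}[X_n] = n$ and $\operatorname{Var}(X_n) = \frac{n^2}{3} + \frac{2n}{3}$. Moreover, writing $\mu_k(n) = \mathbb{E}\big[(X_n - \mathbb{E}X_n)^k\big] / \operatorname{Var}(X_n)^{k/2}$ for the $k$-th standardized central moment, as $n \to \infty$ the values $\mu_3(n),\mu_4(n),\dots,\mu_{10}(n)$ converge respectively to $0,\ \tfrac{9}{5},\ 0,\ \tfrac{27}{7},\ 0,\ 9,\ 0,\ \tfrac{243}{11}$.
   Context: A walk is encoded as a string $w = w_1 w_2 \cdots w_m$ with $w_i \in \{ -1, 1\}$, where $w_i = -1$ denotes a right step $(1,0)$ and $w_i = 1$ denotes an up step $(0,1)$; a walk to $(n,n)$ has $m = 2n$ steps. Let $S_i = \sum_{j=1}^{i} w_j$ (with $S_0 = 0$). The number of losing times of $w$ is $a_1(w) = \left|\{ i \in \{1,\dots,m\} : S_i < 0 \text{ or } (S_i = 0 \text{ and } S_{i-1} < 0)\}\right|$, i.e., the number of steps at which the walk is below the line $y=x$ (a step returning to the diagonal from below also counts). -}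

module Defs where

open import Data.Nat as ℕ using (ℕ; zero; suc)
open import Data.Integer as ℤ using (ℤ; +_; -[1+_])
open import Data.Rational as ℚ using (ℚ; 0ℚ; 1ℚ; _+_; _-_; _*_; _÷_; _<_; ∣_∣)
open import Data.Rational.Properties using (_≟_)
open import Data.List using (List; []; _∷_; [_]; map; _++_; length; foldr)
open import Data.Bool using (if_then_else_)
open import Relation.Nullary using (yes; no)
open import Relation.Nullary.Decidable using (⌊_⌋; _⊎-dec_; _×-dec_)
open import Relation.Binary.PropositionalEquality using (_≡_)

-- A walk is a list of steps w_i ∈ {-1, 1} (−1 = right step (1,0), +1 = up step (0,1)).
Walk : Set
Walk = List ℤ

walks : ℕ → ℕ → List Walk
walks zero    zero    = [ [] ]
walks (suc r) zero    = map (ℤ.-1ℤ ∷_) (walks r zero)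
walks zero    (suc u) = map (ℤ.1ℤ ∷_) (walks zero u)
walks (suc r) (suc u) = map (ℤ.-1ℤ ∷_) (walks r (suc u)) ++ map (ℤ.1ℤ ∷_) (walks (suc r) u)

W : ℕ → List Walk
W n = walks n n

-- number of losing times, computed with the running partial sum S_{i-1}:
-- step i counts iff S_i < 0 or (S_i = 0 and S_{i-1} < 0).
losing : ℤ → Walk → ℕ
losing s []       = 0
losing s (x ∷ xs) =
  let s' = s ℤ.+ x in
  (if ⌊ (s' ℤ.<? ℤ.0ℤ) ⊎-dec ((s' ℤ.≟ ℤ.0ℤ) ×-dec (s ℤ.<? ℤ.0ℤ)) ⌋ then 1 else 0)
  ℕ.+ losing s' xs

a₁ : Walk → ℕ
a₁ w = losing ℤ.0ℤ w

toℚ : ℕ → ℚ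
toℚ n = (+ n) ℚ./ 1

_^_ : ℚ → ℕ → ℚ
p ^ zero  = 1ℚ
p ^ suc k = p * (p ^ k)

-- division made total (value 0 when dividing by 0)
_÷′_ : ℚ → ℚ → ℚ
p ÷′ q with q ≟ 0ℚ
... | yes _  = 0ℚ
... | no q≢0 = _÷_ p q {{ℚ.≢-nonZero q≢0}}

mean : List ℚ → ℚ
mean []       = 0ℚ
mean (x ∷ xs) = foldr _+_ 0ℚ (x ∷ xs) * ((+ 1) ℚ./ suc (length xs))

-- X_n as a list of values over the uniform sample space W_{n,n}
Xs : ℕ → List ℚ
Xs n = map (λ w → toℚ (a₁ w)) (W n)

E : ℕ → ℚ
E n = mean (Xs n)

central : ℕ → ℕ → ℚ
central k n = mean (map (λ x → (x - E n) ^ k) (Xs n))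

Var : ℕ → ℚ
Var n = central 2 n

μ-even : ℕ → ℕ → ℚ
μ-even j n = central (2 ℕ.* j) n ÷′ (Var n ^ j)

μ² : ℕ → ℕ → ℚ
μ² k n = (central k n ^ 2) ÷′ (Var n ^ k)

_⟶_ : (ℕ → ℚ) → ℚ → Set
f ⟶ L = ∀ (ε : ℚ) → 0ℚ < ε → Data.Product.∃ λ N → ∀ n → N ℕ.≤ n → ∣ f n - L ∣ < ε
  where import Data.Product

module Submission where

-- By the Chung–Feller theorem a₁ is uniformly distributed on {0, 2, …, 2n} over W n: cutting a walk
-- at its first return to the diagonal and inducting, each of these values is taken by exactly
-- catalan n walks. Hence X n - n is uniform on {-n, -n + 2, …, n}, its odd central moments vanish,
-- and since passing from n to n + 2 adds the two points ±(n + 2), the 2j-th central moment is a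
-- polynomial of degree j in u = n (n + 2) = 3 Var X n, fixed by that recursion. The 2j-th
-- standardised moment is therefore 3ʲ times its leading coefficient, up to O(1/n).

module ChungFeller where
  open import Defs
  open import Data.Nat using (ℕ; zero; suc; _+_; _*_; _≤_; _<_; s≤s)
  open import Data.Nat.Properties
    using (+-suc; +-comm; +-assoc; +-identityʳ; *-zeroʳ; *-identityʳ; *-comm; m≤n+m)
  open import Data.Nat.Induction using (<-rec)
  open import Data.Nat.Tactic.RingSolver using (solve-∀)
  open import Data.Integer as ℤ using (-[1+_])
  open import Data.List using (List; []; _∷_; [_]; map; _++_; length)
  open import Data.List.Properties using (map-++; map-cong; map-∘; map-id; length-++)
  import Data.List.Properties as List
  open import Data.List.Relation.Binary.Permutation.Propositional
    using (_↭_; ↭-refl; ↭-sym; ↭-trans; ↭-reflexive; module PermutationReasoning)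
  open import Data.List.Relation.Binary.Permutation.Propositional.Properties
    using (map⁺; ++⁺ˡ; ++⁺; ++-comm; ++-commutativeMonoid)
  open import Algebra.Bundles using (CommutativeMonoid)
  import Algebra.Properties.CommutativeSemigroup as CommutativeSemigroupProperties
  open import Function using (_∘_)
  open import Data.Product using (∃; _,_)
  open import Relation.Binary.PropositionalEquality
    using (_≡_; refl; sym; trans; cong; cong₂; subst; module ≡-Reasoning)

  private
    variable
      A B : Set

  copies : ℕ → List A → List A
  copies zero    xs = []
  copies (suc k) xs = xs ++ copies k xs

  concatAntidiagonal : (ℕ → ℕ → List A) → ℕ → List A
  concatAntidiagonal F zero    = F 0 0
  concatAntidiagonal F (suc n) = F 0 (suc n) ++ concatAntidiagonal (λ i → F (suc i)) n

  sumAntidiagonal : (ℕ → ℕ → ℕ) → ℕ → ℕ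
  sumAntidiagonal f zero    = f 0 0
  sumAntidiagonal f (suc n) = f 0 (suc n) + sumAntidiagonal (λ i → f (suc i)) n

  ++-interchange : (ws xs ys zs : List A) → (ws ++ xs) ++ (ys ++ zs) ↭ (ws ++ ys) ++ (xs ++ zs)
  ++-interchange {A} = CommutativeSemigroupProperties.interchange
    (CommutativeMonoid.commutativeSemigroup (++-commutativeMonoid {A = A}))

  map-copies : ∀ (f : A → B) k xs → map f (copies k xs) ≡ copies k (map f xs)
  map-copies f zero    xs = refl
  map-copies f (suc k) xs = trans (map-++ f xs (copies k xs)) (cong (map f xs ++_) (map-copies f k xs))

  copies-+ : ∀ k l (xs : List A) → copies (k + l) xs ≡ copies k xs ++ copies l xs
  copies-+ zero    l xs = refl
  copies-+ (suc k) l xs =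
    trans (cong (xs ++_) (copies-+ k l xs)) (sym (List.++-assoc xs (copies k xs) (copies l xs)))

  copies-* : ∀ k l (xs : List A) → copies k (copies l xs) ≡ copies (k * l) xs
  copies-* zero    l xs = refl
  copies-* (suc k) l xs = trans (cong (copies l xs ++_) (copies-* k l xs)) (sym (copies-+ l (k * l) xs))

  copies-++ : ∀ k (xs ys : List A) → copies k xs ++ copies k ys ↭ copies k (xs ++ ys)
  copies-++ zero    xs ys = ↭-refl
  copies-++ (suc k) xs ys = ↭-trans (++-interchange xs (copies k xs) ys (copies k ys))
                                    (++⁺ˡ (xs ++ ys) (copies-++ k xs ys))

  copies⁺ : ∀ k {xs ys : List A} → xs ↭ ys → copies k xs ↭ copies k ys
  copies⁺ zero    p = ↭-refl
  copies⁺ (suc k) p = ++⁺ p (copies⁺ k p)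

  copies-[] : ∀ k → copies {A = A} k [] ≡ []
  copies-[] zero    = refl
  copies-[] (suc k) = copies-[] k

  length-copies : ∀ k (xs : List A) → length (copies k xs) ≡ k * length xs
  length-copies zero    xs = refl
  length-copies (suc k) xs = trans (length-++ xs) (cong (length xs +_) (length-copies k xs))

  map-concatAntidiagonal : ∀ (f : A → B) F n →
    map f (concatAntidiagonal F n) ≡ concatAntidiagonal (λ i k → map f (F i k)) n
  map-concatAntidiagonal f F zero    = refl
  map-concatAntidiagonal f F (suc n) =
    trans (map-++ f (F 0 (suc n)) _) (cong (map f (F 0 (suc n)) ++_) (map-concatAntidiagonal f _ n))

  concatAntidiagonal-cong : ∀ {F G : ℕ → ℕ → List A} n → (∀ i k → F i k ≡ G i k) →
    concatAntidiagonal F n ≡ concatAntidiagonal G n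
  concatAntidiagonal-cong zero    eq = eq 0 0
  concatAntidiagonal-cong (suc n) eq =
    cong₂ _++_ (eq 0 (suc n)) (concatAntidiagonal-cong n (λ i → eq (suc i)))

  concatAntidiagonal⁺ : ∀ {F G : ℕ → ℕ → List A} n → (∀ i k → i + k ≡ n → F i k ↭ G i k) →
    concatAntidiagonal F n ↭ concatAntidiagonal G n
  concatAntidiagonal⁺ zero    p = p 0 0 refl
  concatAntidiagonal⁺ (suc n) p =
    ++⁺ (p 0 (suc n) refl) (concatAntidiagonal⁺ n (λ i k e → p (suc i) k (cong suc e)))

  concatAntidiagonal-++ : ∀ (F G : ℕ → ℕ → List A) n →
    concatAntidiagonal (λ i k → F i k ++ G i k) n ↭ concatAntidiagonal F n ++ concatAntidiagonal G n
  concatAntidiagonal-++ F G zero    = ↭-refl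
  concatAntidiagonal-++ F G (suc n) = ↭-trans
    (++⁺ˡ (F 0 (suc n) ++ G 0 (suc n)) (concatAntidiagonal-++ (λ i → F (suc i)) (λ i → G (suc i)) n))
    (++-interchange (F 0 (suc n)) (G 0 (suc n)) _ _)

  concatAntidiagonal-snoc : ∀ (F : ℕ → ℕ → List A) n →
    concatAntidiagonal F (suc n) ≡ concatAntidiagonal (λ i k → F i (suc k)) n ++ F (suc n) 0
  concatAntidiagonal-snoc F zero    = refl
  concatAntidiagonal-snoc F (suc n) =
    trans (cong (F 0 (suc (suc n)) ++_) (concatAntidiagonal-snoc (λ i → F (suc i)) n))
          (sym (List.++-assoc (F 0 (suc (suc n))) _ _))

  concatAntidiagonal-transpose : ∀ (F : ℕ → ℕ → List A) n →
    concatAntidiagonal F n ↭ concatAntidiagonal (λ i k → F k i) n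
  concatAntidiagonal-transpose F zero    = ↭-refl
  concatAntidiagonal-transpose F (suc n) = begin
    F 0 (suc n) ++ concatAntidiagonal (λ i → F (suc i)) n
      ↭⟨ ++⁺ˡ (F 0 (suc n)) (concatAntidiagonal-transpose _ n) ⟩
    F 0 (suc n) ++ concatAntidiagonal (λ i k → F (suc k) i) n
      ↭⟨ ++-comm (F 0 (suc n)) _ ⟩
    concatAntidiagonal (λ i k → F (suc k) i) n ++ F 0 (suc n)
      ≡⟨ concatAntidiagonal-snoc (λ i k → F k i) n ⟨
    concatAntidiagonal (λ i k → F k i) (suc n) ∎
    where open PermutationReasoning

  concatAntidiagonal-copies : ∀ (f : ℕ → ℕ → ℕ) (xs : List A) n →
    concatAntidiagonal (λ i k → copies (f i k) xs) n ≡ copies (sumAntidiagonal f n) xs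
  concatAntidiagonal-copies f xs zero    = refl
  concatAntidiagonal-copies f xs (suc n) =
    trans (cong (copies (f 0 (suc n)) xs ++_) (concatAntidiagonal-copies (λ i → f (suc i)) xs n))
          (sym (copies-+ (f 0 (suc n)) _ xs))

  -- firstPassages s j counts the walks from height s > 0 that first reach the diagonal after s + 2 j steps.
  firstPassages : ℕ → ℕ → ℕ
  firstPassages s       zero    = 1
  firstPassages zero    (suc j) = 0
  firstPassages (suc s) (suc j) = firstPassages s (suc j) + firstPassages (suc (suc s)) j

  catalan : ℕ → ℕ
  catalan = firstPassages 1

  firstPassages-suc : ∀ s j → ∃ λ c → firstPassages (suc s) j ≡ suc c
  firstPassages-suc s zero    = 0 , refl
  firstPassages-suc s (suc j) with c , eq ← firstPassages-suc (suc s) j =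
    firstPassages s (suc j) + c , trans (cong (firstPassages s (suc j) +_) eq) (+-suc _ c)

  sumAntidiagonal-*-firstPassages₀ : ∀ (g : ℕ → ℕ) j →
    sumAntidiagonal (λ i k → g i * firstPassages 0 k) j ≡ g j
  sumAntidiagonal-*-firstPassages₀ g zero    = *-identityʳ (g 0)
  sumAntidiagonal-*-firstPassages₀ g (suc j) =
    trans (cong (_+ sumAntidiagonal (λ i k → g (suc i) * firstPassages 0 k) j) (*-zeroʳ (g 0)))
          (sumAntidiagonal-*-firstPassages₀ (λ i → g (suc i)) j)

  sumAntidiagonal-*-split : ∀ (b b′ b″ : ℕ → ℕ) → b 0 ≡ b′ 0 → (∀ k → b (suc k) ≡ b′ (suc k) + b″ k) →
    ∀ j (a : ℕ → ℕ) → sumAntidiagonal (λ i k → a i * b k) (suc j)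
                    ≡ sumAntidiagonal (λ i k → a i * b′ k) (suc j) + sumAntidiagonal (λ i k → a i * b″ k) j
  sumAntidiagonal-*-split b b′ b″ b₀ bₛ zero a = begin
    a 0 * b 1 + a 1 * b 0                       ≡⟨ cong₂ (λ x y → a 0 * x + a 1 * y) (bₛ 0) b₀ ⟩
    a 0 * (b′ 1 + b″ 0) + a 1 * b′ 0            ≡⟨ distrib (a 0) (a 1) (b′ 1) (b″ 0) (b′ 0) ⟩
    (a 0 * b′ 1 + a 1 * b′ 0) + a 0 * b″ 0      ∎
    where
    open ≡-Reasoning
    distrib : ∀ a₀ a₁ x z y → a₀ * (x + z) + a₁ * y ≡ (a₀ * x + a₁ * y) + a₀ * z
    distrib = solve-∀
  sumAntidiagonal-*-split b b′ b″ b₀ bₛ (suc j) a = begin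
    a 0 * b (2 + j) + Σ a′ b (suc j)
      ≡⟨ cong₂ (λ x y → a 0 * x + y) (bₛ (suc j)) (sumAntidiagonal-*-split b b′ b″ b₀ bₛ j a′) ⟩
    a 0 * (b′ (2 + j) + b″ (suc j)) + (Σ a′ b′ (suc j) + Σ a′ b″ j)
      ≡⟨ distrib (a 0) (b′ (2 + j)) (b″ (suc j)) (Σ a′ b′ (suc j)) (Σ a′ b″ j) ⟩
    (a 0 * b′ (2 + j) + Σ a′ b′ (suc j)) + (a 0 * b″ (suc j) + Σ a′ b″ j) ∎
    where
    open ≡-Reasoning
    a′ : ℕ → ℕ
    a′ i = a (suc i)
    Σ : (ℕ → ℕ) → (ℕ → ℕ) → ℕ → ℕ
    Σ f g = sumAntidiagonal (λ i k → f i * g k)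
    distrib : ∀ a₀ x y P Q → a₀ * (x + y) + (P + Q) ≡ (a₀ * x + P) + (a₀ * y + Q)
    distrib = solve-∀

  -- A first passage from height s + 1 to 0 splits where it first reaches height s.
  sumAntidiagonal-catalan-firstPassages : ∀ s j →
    sumAntidiagonal (λ i k → catalan i * firstPassages s k) j ≡ firstPassages (suc s) j
  sumAntidiagonal-catalan-firstPassages s       zero    = refl
  sumAntidiagonal-catalan-firstPassages zero    (suc j) = sumAntidiagonal-*-firstPassages₀ (λ i → catalan (suc i)) j
  sumAntidiagonal-catalan-firstPassages (suc s) (suc j) = trans
    (sumAntidiagonal-*-split (firstPassages (suc s)) (firstPassages s) (firstPassages (suc (suc s)))
                             refl (λ _ → refl) j catalan)
    (cong₂ _+_ (sumAntidiagonal-catalan-firstPassages s (suc j))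
               (sumAntidiagonal-catalan-firstPassages (suc (suc s)) j))

  a₁-values : ℕ → List ℕ
  a₁-values n = map a₁ (W n)

  -- The values of a₁ on the walks from height t + 1 above, resp. below, the diagonal back to it.
  fromAbove : ℕ → ℕ → List ℕ
  fromAbove t u = map (losing (ℤ.+ suc t)) (walks (suc t + u) u)

  fromBelow : ℕ → ℕ → List ℕ
  fromBelow t r = map (losing -[1+ t ]) (walks r (suc t + r))

  losing-right-above : ∀ t w → losing (ℤ.+ suc t) (ℤ.-1ℤ ∷ w) ≡ losing (ℤ.+ t) w
  losing-right-above zero    w = refl
  losing-right-above (suc t) w = refl

  losing-up-above : ∀ t w → losing (ℤ.+ suc t) (ℤ.1ℤ ∷ w) ≡ losing (ℤ.+ suc (suc t)) w
  losing-up-above zero    w = refl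
  losing-up-above (suc t) w = cong (λ k → losing (ℤ.+ suc (suc k)) w) (+-comm t 1)

  losing-up-below : ∀ t w → losing -[1+ suc t ] (ℤ.1ℤ ∷ w) ≡ suc (losing -[1+ t ] w)
  losing-up-below t w = refl

  losing-right-below : ∀ t w → losing -[1+ t ] (ℤ.-1ℤ ∷ w) ≡ suc (losing -[1+ suc t ] w)
  losing-right-below t w = cong (λ k → suc (losing -[1+ suc k ] w)) (+-identityʳ t)

  map-∷ : ∀ (f g : Walk → ℕ) x ws → (∀ w → f (x ∷ w) ≡ g w) → map f (map (x ∷_) ws) ≡ map g ws
  map-∷ f g x ws eq = trans (sym (map-∘ ws)) (map-cong eq ws)

  -- Cut a walk from height s at its first visit to the diagonal: a first passage of length s + 2 j,
  -- each of whose steps adds c to a₁ (a of them already counted), followed by a walk of W m.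
  decomposition : ℕ → ℕ → ℕ → ℕ → List ℕ
  decomposition c a s u = concatAntidiagonal
    (λ j m → copies (firstPassages s j) (map ((a + 2 * j) * c +_) (a₁-values m))) u

  map-+-map-+ : ∀ c d xs → map (c +_) (map (d +_) xs) ≡ map (c + d +_) xs
  map-+-map-+ c d xs = trans (sym (map-∘ xs)) (map-cong (λ x → sym (+-assoc c d x)) xs)

  map-+-decomposition : ∀ c a s u → map (c +_) (decomposition c a s u) ≡ decomposition c (suc a) s u
  map-+-decomposition c a s u = trans (map-concatAntidiagonal (c +_) _ u)
    (concatAntidiagonal-cong u (λ j m → trans (map-copies (c +_) (firstPassages s j) _)
      (cong (copies (firstPassages s j)) (map-+-map-+ c ((a + 2 * j) * c) (a₁-values m)))))

  concatAntidiagonal-[] : ∀ n → concatAntidiagonal {A = A} (λ _ _ → []) n ≡ []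
  concatAntidiagonal-[] zero    = refl
  concatAntidiagonal-[] (suc n) = concatAntidiagonal-[] n

  decomposition-firstPassages₀ : ∀ c u → decomposition c 1 0 (suc u) ≡ map (c +_) (a₁-values (suc u))
  decomposition-firstPassages₀ c u = begin
    (map (c + 0 +_) N ++ []) ++ concatAntidiagonal (λ _ _ → []) u
      ≡⟨ cong₂ _++_ (List.++-identityʳ _) (concatAntidiagonal-[] u) ⟩
    map (c + 0 +_) N ++ []
      ≡⟨ List.++-identityʳ _ ⟩
    map (c + 0 +_) N
      ≡⟨ cong (λ d → map (d +_) N) (+-identityʳ c) ⟩
    map (c +_) N ∎
    where
    open ≡-Reasoning
    N = a₁-values (suc u)

  -- The Pascal-type recursion of firstPassages s (suc j) merges the two halves.
  decomposition-merge : ∀ c s u →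
    decomposition c (suc s) s (suc u) ++ decomposition c (3 + s) (2 + s) u ↭ decomposition c (suc s) (suc s) (suc u)
  decomposition-merge c s u = begin
    (F₀ ++ concatAntidiagonal G u) ++ concatAntidiagonal H′ u
      ≡⟨ cong ((F₀ ++ concatAntidiagonal G u) ++_) (concatAntidiagonal-cong u (λ i k →
           cong (λ e → copies (firstPassages (2 + s) i) (map (e * c +_) (a₁-values k))) (offset s i))) ⟩
    (F₀ ++ concatAntidiagonal G u) ++ concatAntidiagonal H u
      ≡⟨ List.++-assoc F₀ _ _ ⟩
    F₀ ++ (concatAntidiagonal G u ++ concatAntidiagonal H u)
      ↭⟨ ++⁺ˡ F₀ (↭-sym (concatAntidiagonal-++ G H u)) ⟩
    F₀ ++ concatAntidiagonal (λ i k → G i k ++ H i k) u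
      ≡⟨ cong (F₀ ++_) (concatAntidiagonal-cong u (λ i k →
           sym (copies-+ (firstPassages s (suc i)) (firstPassages (2 + s) i) _))) ⟩
    decomposition c (suc s) (suc s) (suc u) ∎
    where
    open PermutationReasoning
    shifted : ℕ → ℕ → List ℕ
    shifted i k = map ((suc s + 2 * suc i) * c +_) (a₁-values k)
    F₀ = copies 1 (map ((suc s + 2 * 0) * c +_) (a₁-values (suc u)))
    G H H′ : ℕ → ℕ → List ℕ
    G i k = copies (firstPassages s (suc i)) (shifted i k)
    H i k = copies (firstPassages (2 + s) i) (shifted i k)
    H′ i k = copies (firstPassages (2 + s) i) (map ((3 + s + 2 * i) * c +_) (a₁-values k))
    offset : ∀ s i → 3 + s + 2 * i ≡ suc s + 2 * suc i
    offset = solve-∀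

  module FirstPassage (c : ℕ) (P : ℕ → ℕ → List ℕ)
    (base  : ∀ t → P t 0 ≡ [ suc t * c ])
    (step₀ : ∀ u → P 0 (suc u) ↭ map (c +_) (a₁-values (suc u)) ++ map (c +_) (P 1 u))
    (stepₛ : ∀ t u → P (suc t) (suc u) ↭ map (c +_) (P t (suc u)) ++ map (c +_) (P (suc (suc t)) u))
    where

    first-passage-decomposition : ∀ t u → P t u ↭ decomposition c (suc t) (suc t) u
    first-passage-decomposition t zero = ↭-reflexive (trans (base t) (cong [_] (offset₀ t c)))
      where
      offset₀ : ∀ t c → suc t * c ≡ (suc t + 2 * 0) * c + 0
      offset₀ = solve-∀
    first-passage-decomposition zero (suc u) = begin
      P 0 (suc u)
        ↭⟨ step₀ u ⟩
      map (c +_) (a₁-values (suc u)) ++ map (c +_) (P 1 u)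
        ↭⟨ ++⁺ (↭-reflexive (sym (decomposition-firstPassages₀ c u)))
               (map⁺ (c +_) (first-passage-decomposition 1 u)) ⟩
      decomposition c 1 0 (suc u) ++ map (c +_) (decomposition c 2 2 u)
        ≡⟨ cong (decomposition c 1 0 (suc u) ++_) (map-+-decomposition c 2 2 u) ⟩
      decomposition c 1 0 (suc u) ++ decomposition c 3 2 u
        ↭⟨ decomposition-merge c 0 u ⟩
      decomposition c 1 1 (suc u) ∎
      where open PermutationReasoning
    first-passage-decomposition (suc t) (suc u) = begin
      P (suc t) (suc u)
        ↭⟨ stepₛ t u ⟩
      map (c +_) (P t (suc u)) ++ map (c +_) (P (2 + t) u)
        ↭⟨ ++⁺ (map⁺ (c +_) (first-passage-decomposition t (suc u)))
               (map⁺ (c +_) (first-passage-decomposition (2 + t) u)) ⟩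
      map (c +_) (decomposition c (suc t) (suc t) (suc u)) ++ map (c +_) (decomposition c (3 + t) (3 + t) u)
        ≡⟨ cong₂ _++_ (map-+-decomposition c (suc t) (suc t) (suc u))
                      (map-+-decomposition c (3 + t) (3 + t) u) ⟩
      decomposition c (2 + t) (suc t) (suc u) ++ decomposition c (4 + t) (3 + t) u
        ↭⟨ decomposition-merge c (suc t) u ⟩
      decomposition c (2 + t) (2 + t) (suc u) ∎
      where open PermutationReasoning

  map-losing-walks : ∀ s r u → map (losing s) (walks (suc r) (suc u))
    ≡ map (λ w → losing s (ℤ.-1ℤ ∷ w)) (walks r (suc u)) ++ map (λ w → losing s (ℤ.1ℤ ∷ w)) (walks (suc r) u)
  map-losing-walks s r u = trans (map-++ (losing s) (map (ℤ.-1ℤ ∷_) (walks r (suc u))) _)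
    (cong₂ _++_ (sym (map-∘ (walks r (suc u)))) (sym (map-∘ (walks (suc r) u))))

  losing-rights : ∀ t → map (losing (ℤ.+ t)) (walks t 0) ≡ [ 0 ]
  losing-rights zero    = refl
  losing-rights (suc t) = trans (map-∷ _ _ _ (walks t 0) (losing-right-above t)) (losing-rights t)

  losing-ups : ∀ t → map (losing -[1+ t ]) (walks 0 (suc t)) ≡ [ suc t ]
  losing-ups zero    = refl
  losing-ups (suc t) = trans (map-∷ _ (suc ∘ losing -[1+ t ]) _ (walks 0 (suc t)) (losing-up-below t))
                             (trans (map-∘ (walks 0 (suc t))) (cong (map suc) (losing-ups t)))

  fromAbove-base : ∀ t → fromAbove t 0 ≡ [ suc t * 0 ]
  fromAbove-base t = trans (cong (λ r → map (losing (ℤ.+ suc t)) (walks r 0)) (+-identityʳ (suc t)))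
    (trans (losing-rights (suc t)) (cong [_] (sym (*-zeroʳ (suc t)))))

  fromAbove-step₀ : ∀ u → fromAbove 0 (suc u) ↭ map (0 +_) (a₁-values (suc u)) ++ map (0 +_) (fromAbove 1 u)
  fromAbove-step₀ u = ↭-reflexive (trans (map-losing-walks (ℤ.+ 1) (suc u) u)
    (sym (cong₂ _++_ (map-id (a₁-values (suc u))) (map-id (fromAbove 1 u)))))

  fromAbove-stepₛ : ∀ t u → fromAbove (suc t) (suc u) ↭ map (0 +_) (fromAbove t (suc u)) ++ map (0 +_) (fromAbove (2 + t) u)
  fromAbove-stepₛ t u = ↭-reflexive (begin
    fromAbove (suc t) (suc u)
      ≡⟨ map-losing-walks (ℤ.+ (2 + t)) (suc (t + suc u)) u ⟩
    map (λ w → losing (ℤ.+ (2 + t)) (ℤ.-1ℤ ∷ w)) (walks (suc t + suc u) (suc u))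
      ++ map (λ w → losing (ℤ.+ (2 + t)) (ℤ.1ℤ ∷ w)) (walks (2 + t + suc u) u)
      ≡⟨ cong₂ _++_ (map-cong (losing-right-above (suc t)) (walks (suc t + suc u) (suc u)))
                    (trans (map-cong (losing-up-above (suc t)) (walks (2 + t + suc u) u))
                           (cong (λ r → map (losing (ℤ.+ (3 + t))) (walks (2 + r) u)) (+-suc t u))) ⟩
    fromAbove t (suc u) ++ fromAbove (2 + t) u
      ≡⟨ cong₂ _++_ (map-id (fromAbove t (suc u))) (map-id (fromAbove (2 + t) u)) ⟨
    map (0 +_) (fromAbove t (suc u)) ++ map (0 +_) (fromAbove (2 + t) u) ∎)
    where open ≡-Reasoning

  fromBelow-base : ∀ t → fromBelow t 0 ≡ [ suc t * 1 ]
  fromBelow-base t = trans (cong (λ u → map (losing -[1+ t ]) (walks 0 u)) (+-identityʳ (suc t)))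
    (trans (losing-ups t) (cong [_] (sym (*-identityʳ (suc t)))))

  fromBelow-step₀ : ∀ r → fromBelow 0 (suc r) ↭ map (1 +_) (a₁-values (suc r)) ++ map (1 +_) (fromBelow 1 r)
  fromBelow-step₀ r = ↭-trans (↭-reflexive (trans (map-losing-walks -[1+ 0 ] r (suc r))
      (cong₂ _++_ (trans (map-cong (losing-right-below 0) (walks r (2 + r))) (map-∘ (walks r (2 + r))))
                  (map-∘ (walks (suc r) (suc r))))))
    (++-comm (map suc (fromBelow 1 r)) (map suc (a₁-values (suc r))))

  fromBelow-stepₛ : ∀ t r → fromBelow (suc t) (suc r) ↭ map (1 +_) (fromBelow t (suc r)) ++ map (1 +_) (fromBelow (2 + t) r)
  fromBelow-stepₛ t r = ↭-trans (↭-reflexive (begin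
    fromBelow (suc t) (suc r)
      ≡⟨ map-losing-walks -[1+ suc t ] r (suc (t + suc r)) ⟩
    map (λ w → losing -[1+ suc t ] (ℤ.-1ℤ ∷ w)) (walks r (2 + t + suc r))
      ++ map (λ w → losing -[1+ suc t ] (ℤ.1ℤ ∷ w)) (walks (suc r) (suc t + suc r))
      ≡⟨ cong₂ _++_ (trans (map-cong (losing-right-below (suc t)) (walks r (2 + t + suc r)))
                           (trans (map-∘ (walks r (2 + t + suc r)))
                                  (cong (λ u → map suc (map (losing -[1+ 2 + t ]) (walks r (2 + u)))) (+-suc t r))))
                    (trans (map-cong (losing-up-below t) (walks (suc r) (suc t + suc r))) (map-∘ (walks (suc r) (suc t + suc r)))) ⟩
    map suc (fromBelow (2 + t) r) ++ map suc (fromBelow t (suc r)) ∎))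
    (++-comm (map suc (fromBelow (2 + t) r)) (map suc (fromBelow t (suc r))))
    where open ≡-Reasoning

  a₁-values-suc : ∀ n → a₁-values (suc n) ≡ map suc (fromBelow 0 n) ++ fromAbove 0 n
  a₁-values-suc n = trans (map-losing-walks ℤ.0ℤ n n) (cong (_++ fromAbove 0 n) (map-∘ (walks n (suc n))))

  module Above = FirstPassage 0 fromAbove fromAbove-base fromAbove-step₀ fromAbove-stepₛ
  module Below = FirstPassage 1 fromBelow fromBelow-base fromBelow-step₀ fromBelow-stepₛ

  evensFrom : ℕ → ℕ → List ℕ
  evensFrom a zero    = []
  evensFrom a (suc l) = a ∷ evensFrom (2 + a) l

  evens : ℕ → List ℕ
  evens n = evensFrom 0 (suc n)

  map-+-evensFrom : ∀ d a l → map (d +_) (evensFrom a l) ≡ evensFrom (d + a) l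
  map-+-evensFrom d a zero    = refl
  map-+-evensFrom d a (suc l) = cong (d + a ∷_)
    (trans (map-+-evensFrom d (2 + a) l) (cong (λ b → evensFrom b l) (trans (+-suc d (suc a)) (cong suc (+-suc d a)))))

  length-evensFrom : ∀ a l → length (evensFrom a l) ≡ l
  length-evensFrom a zero    = refl
  length-evensFrom a (suc l) = cong suc (length-evensFrom (2 + a) l)

  evensFrom-++ : ∀ a l l′ → evensFrom a l ++ evensFrom (2 * l + a) l′ ≡ evensFrom a (l + l′)
  evensFrom-++ a zero    l′ = refl
  evensFrom-++ a (suc l) l′ = cong (a ∷_)
    (trans (cong (λ b → evensFrom (2 + a) l ++ evensFrom b l′) (offset l a)) (evensFrom-++ (2 + a) l l′))
    where
    offset : ∀ l a → 2 * suc l + a ≡ 2 * l + (2 + a)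
    offset = solve-∀

  evens-++ : ∀ j m → evens m ++ evensFrom (2 + 2 * m) (suc j) ≡ evens (suc (j + m))
  evens-++ j m = trans (cong (λ b → evens m ++ evensFrom b (suc j)) (offset m))
    (trans (evensFrom-++ 0 (suc m) (suc j)) (cong (evensFrom 0) (length-sum j m)))
    where
    offset : ∀ m → 2 + 2 * m ≡ 2 * suc m + 0
    offset = solve-∀
    length-sum : ∀ j m → suc m + suc j ≡ suc (suc (j + m))
    length-sum = solve-∀

  evens-suc : ∀ n → evens (suc n) ≡ evens n ++ [ 2 * suc n ]
  evens-suc n = sym (trans (cong (λ a → evens n ++ evensFrom a 1) (sym (+-identityʳ (2 * suc n))))
    (trans (evensFrom-++ 0 (suc n) 1) (cong (λ l → evensFrom 0 (suc l)) (+-comm n 1))))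

  evens-2+ : ∀ n → evens (2 + n) ≡ 0 ∷ (map (2 +_) (evens n) ++ [ 2 * suc n + 2 ])
  evens-2+ n = cong (0 ∷_) (sym (trans (cong (_++ [ 2 * suc n + 2 ]) (map-+-evensFrom 2 0 (suc n)))
    (trans (evensFrom-++ 2 (suc n) 1) (cong (λ l → evensFrom 2 (suc l)) (+-comm n 1)))))

  ChungFellerUpTo : ℕ → Set
  ChungFellerUpTo n = ∀ m → m ≤ n → a₁-values m ↭ copies (catalan m) (evens m)

  decomposition-evens : ∀ c a s n → ChungFellerUpTo n → decomposition c a s n ↭
    concatAntidiagonal (λ j m → copies (firstPassages s j) (copies (catalan m) (map ((a + 2 * j) * c +_) (evens m)))) n
  decomposition-evens c a s n ih = concatAntidiagonal⁺ n (λ j m j+m≡n → ↭-trans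
    (copies⁺ (firstPassages s j) (map⁺ _ (ih m (subst (m ≤_) j+m≡n (m≤n+m m j)))))
    (↭-reflexive (cong (copies (firstPassages s j)) (map-copies _ (catalan m) (evens m)))))

  -- A walk of W (suc n) is a first excursion of length 2 (suc j) followed by a walk of W m, j + m = n;
  -- an excursion below the diagonal adds its whole length to a₁.
  a₁-values-first-return : ∀ n → ChungFellerUpTo n → a₁-values (suc n) ↭ concatAntidiagonal (λ j m →
    copies (catalan j) (copies (catalan m) (evens m))
      ++ copies (catalan m) (copies (catalan j) (evensFrom (2 + 2 * m) (suc j)))) n
  a₁-values-first-return n ih = begin
    a₁-values (suc n)
      ≡⟨ a₁-values-suc n ⟩
    map suc (fromBelow 0 n) ++ fromAbove 0 n
      ↭⟨ ++⁺ (map⁺ suc (Below.first-passage-decomposition 0 n)) (Above.first-passage-decomposition 0 n) ⟩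
    map suc (decomposition 1 1 1 n) ++ decomposition 0 1 1 n
      ≡⟨ cong (_++ decomposition 0 1 1 n) (map-+-decomposition 1 1 1 n) ⟩
    decomposition 1 2 1 n ++ decomposition 0 1 1 n
      ↭⟨ ++⁺ (decomposition-evens 1 2 1 n ih) (decomposition-evens 0 1 1 n ih) ⟩
    concatAntidiagonal (λ j m → copies (catalan j) (copies (catalan m) (map ((2 + 2 * j) * 1 +_) (evens m)))) n
      ++ concatAntidiagonal (λ j m → copies (catalan j) (copies (catalan m) (map ((1 + 2 * j) * 0 +_) (evens m)))) n
      ≡⟨ cong₂ _++_ (concatAntidiagonal-cong n (λ j m → cong (λ xs → copies (catalan j) (copies (catalan m) xs)) (below j m)))
                    (concatAntidiagonal-cong n (λ j m → cong (λ xs → copies (catalan j) (copies (catalan m) xs)) (above j m))) ⟩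
    concatAntidiagonal Below n ++ concatAntidiagonal Above n
      ↭⟨ ++-comm (concatAntidiagonal Below n) (concatAntidiagonal Above n) ⟩
    concatAntidiagonal Above n ++ concatAntidiagonal Below n
      ↭⟨ ++⁺ˡ (concatAntidiagonal Above n) (concatAntidiagonal-transpose Below n) ⟩
    concatAntidiagonal Above n ++ concatAntidiagonal (λ j m → Below m j) n
      ↭⟨ concatAntidiagonal-++ Above (λ j m → Below m j) n ⟨
    concatAntidiagonal (λ j m → Above j m ++ Below m j) n ∎
    where
    open PermutationReasoning
    Above Below : ℕ → ℕ → List ℕ
    Above j m = copies (catalan j) (copies (catalan m) (evens m))
    Below j m = copies (catalan j) (copies (catalan m) (evensFrom (2 + 2 * j) (suc m)))
    below : ∀ j m → map ((2 + 2 * j) * 1 +_) (evens m) ≡ evensFrom (2 + 2 * j) (suc m)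
    below j m = trans (map-+-evensFrom _ 0 (suc m))
      (cong (λ a → evensFrom a (suc m)) (trans (+-identityʳ _) (*-identityʳ (2 + 2 * j))))
    above : ∀ j m → map ((1 + 2 * j) * 0 +_) (evens m) ≡ evens m
    above j m = trans (map-cong (λ x → cong (_+ x) (*-zeroʳ (1 + 2 * j))) (evens m)) (map-id (evens m))

  chung-feller-step : ∀ n → ChungFellerUpTo n → a₁-values (suc n) ↭ copies (catalan (suc n)) (evens (suc n))
  chung-feller-step n ih = begin
    a₁-values (suc n)
      ↭⟨ a₁-values-first-return n ih ⟩
    concatAntidiagonal (λ j m → copies (catalan j) (copies (catalan m) (evens m))
      ++ copies (catalan m) (copies (catalan j) (evensFrom (2 + 2 * m) (suc j)))) n
      ↭⟨ concatAntidiagonal⁺ n combine ⟩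
    concatAntidiagonal (λ j m → copies (catalan j * catalan m) (evens (suc n))) n
      ≡⟨ concatAntidiagonal-copies (λ j m → catalan j * catalan m) (evens (suc n)) n ⟩
    copies (sumAntidiagonal (λ j m → catalan j * catalan m) n) (evens (suc n))
      ≡⟨ cong (λ k → copies k (evens (suc n))) (sumAntidiagonal-catalan-firstPassages 1 n) ⟩
    copies (catalan (suc n)) (evens (suc n)) ∎
    where
    open PermutationReasoning
    combine : ∀ j m → j + m ≡ n →
      copies (catalan j) (copies (catalan m) (evens m)) ++ copies (catalan m) (copies (catalan j) (evensFrom (2 + 2 * m) (suc j)))
        ↭ copies (catalan j * catalan m) (evens (suc n))
    combine j m refl = begin
      copies (catalan j) (copies (catalan m) (evens m)) ++ copies (catalan m) (copies (catalan j) Bs)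
        ≡⟨ cong₂ _++_ (copies-* (catalan j) (catalan m) (evens m))
                      (trans (copies-* (catalan m) (catalan j) Bs) (cong (λ k → copies k Bs) (*-comm (catalan m) (catalan j)))) ⟩
      copies (catalan j * catalan m) (evens m) ++ copies (catalan j * catalan m) Bs
        ↭⟨ copies-++ (catalan j * catalan m) (evens m) Bs ⟩
      copies (catalan j * catalan m) (evens m ++ Bs)
        ≡⟨ cong (copies (catalan j * catalan m)) (evens-++ j m) ⟩
      copies (catalan j * catalan m) (evens (suc (j + m))) ∎
      where Bs = evensFrom (2 + 2 * m) (suc j)

  chung-feller : ∀ n → a₁-values n ↭ copies (catalan n) (evens n)
  chung-feller = <-rec (λ n → a₁-values n ↭ copies (catalan n) (evens n)) step
    where
    step : ∀ n → (∀ {m} → m < n → a₁-values m ↭ copies (catalan m) (evens m)) → a₁-values n ↭ copies (catalan n) (evens n)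
    step zero    _  = ↭-refl
    step (suc n) ih = chung-feller-step n (λ m m≤n → ih (s≤s m≤n))

module Moments where
  open import Defs
  open import Data.Nat as ℕ using (ℕ; zero; suc; s≤s)
  import Data.Nat.Properties as ℕ
  open import Data.Integer as ℤ using (ℤ; -[1+_])
  open import Data.Rational
    using (ℚ; 0ℚ; _+_; _*_; _-_; -_; _/_; 1/_; _≤_; _<_; ∣_∣; mkℚ; toℚᵘ;
           positive; nonNegative; ≢-nonZero; *<*)
  import Data.Rational.Properties as ℚ
  import Data.Rational.Unnormalised as ℚᵘ
  import Data.Rational.Unnormalised.Properties as ℚᵘ
  import Data.Rational.Literals as ℚ-Literals
  import Data.Nat.Literals as ℕ-Literals
  import Data.Integer.Literals as ℤ-Literals
  open import Data.Nat.Coprimality using (Coprime)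
  open import Data.List using (List; []; _∷_; [_]; map; _++_; foldr; length)
  open import Data.List.Properties using (map-++; map-cong; map-∘; length-map; length-++)
  open import Data.List.Relation.Binary.Permutation.Propositional using (_↭_; ↭-sym; ↭⇒↭ₛ′)
  open import Data.List.Relation.Binary.Permutation.Propositional.Properties
    using (map⁺; ↭-length; ↭-empty-inv)
  open import Data.List.Relation.Binary.Permutation.Setoid.Properties ℚ.≡-setoid using (foldr-commMonoid)
  open import Agda.Builtin.FromNat using (Number; fromNat)
  open import Data.Maybe using (Maybe; just; nothing)
  open import Data.Unit using (⊤)
  open import Data.Product using (∃; _,_)
  open import Data.Empty using (⊥-elim)
  open import Level using (0ℓ)
  open import Relation.Nullary using (yes; no)
  open import Relation.Nullary.Decidable using (True; toWitness)
  open import Relation.Binary.PropositionalEquality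
    using (_≡_; refl; sym; trans; cong; cong₂; subst; isEquivalence; module ≡-Reasoning)
  open import Tactic.RingSolver using (solve-∀)
  import Tactic.RingSolver.Core.AlmostCommutativeRing as ACR
  import Data.Integer.Tactic.RingSolver as ℤ-Solver
  open ChungFeller

  instance
    ℕ-number : Number ℕ
    ℕ-number = ℕ-Literals.number
    ℤ-number : Number ℤ
    ℤ-number = ℤ-Literals.number
    ℚ-number : Number ℚ
    ℚ-number = ℚ-Literals.number

  ℚ-ring : ACR.AlmostCommutativeRing 0ℓ 0ℓ
  ℚ-ring = ACR.fromCommutativeRing ℚ.+-*-commutativeRing isZero
    where
    isZero : ∀ q → Maybe (0ℚ ≡ q)
    isZero q with 0ℚ ℚ.≟ q
    ... | yes e = just e
    ... | no  _ = nothing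

  toℚᵘ-toℚ : ∀ n → toℚᵘ (toℚ n) ℚᵘ.≃ ℚᵘ.mkℚᵘ (ℤ.+ n) 0
  toℚᵘ-toℚ n = ℚ.toℚᵘ-fromℚᵘ (ℚᵘ.mkℚᵘ (ℤ.+ n) 0)

  toℚ-suc : ∀ n → toℚ (suc n) ≡ 1 + toℚ n
  toℚ-suc n = ℚ.toℚᵘ-injective (begin
    toℚᵘ (toℚ (suc n))                 ≈⟨ toℚᵘ-toℚ (suc n) ⟩
    ℚᵘ.mkℚᵘ (ℤ.+ suc n) 0              ≈⟨ ℚᵘ.*≡* (one-plus (ℤ.+ n)) ⟩
    toℚᵘ 1 ℚᵘ.+ ℚᵘ.mkℚᵘ (ℤ.+ n) 0      ≈⟨ ℚᵘ.+-congʳ (toℚᵘ 1) (toℚᵘ-toℚ n) ⟨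
    toℚᵘ 1 ℚᵘ.+ toℚᵘ (toℚ n)           ≈⟨ ℚ.toℚᵘ-homo-+ 1 (toℚ n) ⟨
    toℚᵘ (1 + toℚ n)                   ∎)
    where
    open ℚᵘ.≃-Reasoning
    one-plus : ∀ n → (1 ℤ.+ n) ℤ.* 1 ≡ (1 ℤ.* 1 ℤ.+ n ℤ.* 1) ℤ.* 1
    one-plus = ℤ-Solver.solve-∀

  toℚ-+ : ∀ m n → toℚ (m ℕ.+ n) ≡ toℚ m + toℚ n
  toℚ-+ zero    n = sym (ℚ.+-identityˡ (toℚ n))
  toℚ-+ (suc m) n = begin
    toℚ (suc (m ℕ.+ n))      ≡⟨ toℚ-suc (m ℕ.+ n) ⟩
    1 + toℚ (m ℕ.+ n)        ≡⟨ cong (1 +_) (toℚ-+ m n) ⟩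
    1 + (toℚ m + toℚ n)      ≡⟨ ℚ.+-assoc 1 (toℚ m) (toℚ n) ⟨
    (1 + toℚ m) + toℚ n      ≡⟨ cong (_+ toℚ n) (toℚ-suc m) ⟨
    toℚ (suc m) + toℚ n      ∎
    where open ≡-Reasoning

  toℚ-* : ∀ m n → toℚ (m ℕ.* n) ≡ toℚ m * toℚ n
  toℚ-* zero    n = sym (ℚ.*-zeroˡ (toℚ n))
  toℚ-* (suc m) n = begin
    toℚ (n ℕ.+ m ℕ.* n)        ≡⟨ toℚ-+ n (m ℕ.* n) ⟩
    toℚ n + toℚ (m ℕ.* n)      ≡⟨ cong (toℚ n +_) (toℚ-* m n) ⟩
    toℚ n + toℚ m * toℚ n      ≡⟨ distrib (toℚ m) (toℚ n) ⟩
    (1 + toℚ m) * toℚ n        ≡⟨ cong (_* toℚ n) (toℚ-suc m) ⟨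
    toℚ (suc m) * toℚ n        ∎
    where
    open ≡-Reasoning
    distrib : ∀ a b → b + a * b ≡ (1 + a) * b
    distrib = solve-∀ ℚ-ring

  toℚ-2+ : ∀ n → toℚ (2 ℕ.+ n) ≡ toℚ n + 2
  toℚ-2+ n = trans (toℚ-+ 2 n) (ℚ.+-comm 2 (toℚ n))

  toℚ-nonNeg : ∀ n → 0ℚ ≤ toℚ n
  toℚ-nonNeg n = ℚ.nonNegative⁻¹ (toℚ n) {{ℚ.normalize-nonNeg n 1}}

  toℚ-mono-≤ : ∀ {m n} → m ℕ.≤ n → toℚ m ≤ toℚ n
  toℚ-mono-≤ {m} {n} m≤n = begin
    toℚ m                      ≡⟨ ℚ.+-identityʳ (toℚ m) ⟨
    toℚ m + 0ℚ                 ≤⟨ ℚ.+-monoʳ-≤ (toℚ m) (toℚ-nonNeg (n ℕ.∸ m)) ⟩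
    toℚ m + toℚ (n ℕ.∸ m)      ≡⟨ toℚ-+ m (n ℕ.∸ m) ⟨
    toℚ (m ℕ.+ (n ℕ.∸ m))      ≡⟨ cong toℚ (ℕ.m+[n∸m]≡n m≤n) ⟩
    toℚ n                      ∎
    where open ℚ.≤-Reasoning

  toℚ-<-suc : ∀ k → toℚ k < toℚ (suc k)
  toℚ-<-suc k = begin-strict
    toℚ k          ≡⟨ ℚ.+-identityˡ (toℚ k) ⟨
    0ℚ + toℚ k     <⟨ ℚ.+-monoˡ-< (toℚ k) (ℚ.positive⁻¹ 1) ⟩
    1 + toℚ k      ≡⟨ toℚ-suc k ⟨
    toℚ (suc k)    ∎
    where open ℚ.≤-Reasoning

  toℚ-suc-*-inverse : ∀ n → toℚ (suc n) * (ℤ.+ 1 / suc n) ≡ 1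
  toℚ-suc-*-inverse n = ℚ.toℚᵘ-injective (begin
    toℚᵘ (toℚ (suc n) * (ℤ.+ 1 / suc n))
      ≈⟨ ℚ.toℚᵘ-homo-* (toℚ (suc n)) (ℤ.+ 1 / suc n) ⟩
    toℚᵘ (toℚ (suc n)) ℚᵘ.* toℚᵘ (ℤ.+ 1 / suc n)
      ≈⟨ ℚᵘ.*-cong (toℚᵘ-toℚ (suc n)) (ℚ.toℚᵘ-fromℚᵘ (ℚᵘ.mkℚᵘ (ℤ.+ 1) n)) ⟩
    ℚᵘ.mkℚᵘ (ℤ.+ suc n) 0 ℚᵘ.* ℚᵘ.mkℚᵘ (ℤ.+ 1) n
      ≈⟨ ℚᵘ.*≡* (trans (ℤ.*-identityʳ _) (trans (cong (λ k → ℤ.+ suc k) (trans (ℕ.*-identityʳ n)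
                   (sym (ℕ.+-identityʳ n)))) (sym (ℤ.*-identityˡ _)))) ⟩
    toℚᵘ 1 ∎)
    where
    open ℚᵘ.≃-Reasoning
    import Data.Integer.Properties as ℤ

  mkℚ-*-toℚ-denominator : ∀ a d .(c : Coprime (suc a) (suc d)) → mkℚ (ℤ.+ suc a) d c * toℚ (suc d) ≡ toℚ (suc a)
  mkℚ-*-toℚ-denominator a d c = ℚ.toℚᵘ-injective (begin
    toℚᵘ (ε * toℚ (suc d))                           ≈⟨ ℚ.toℚᵘ-homo-* ε (toℚ (suc d)) ⟩
    ℚᵘ.mkℚᵘ (ℤ.+ suc a) d ℚᵘ.* toℚᵘ (toℚ (suc d))    ≈⟨ ℚᵘ.*-congˡ {ℚᵘ.mkℚᵘ (ℤ.+ suc a) d} (toℚᵘ-toℚ (suc d)) ⟩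
    ℚᵘ.mkℚᵘ (ℤ.+ suc a) d ℚᵘ.* ℚᵘ.mkℚᵘ (ℤ.+ suc d) 0
      ≈⟨ ℚᵘ.*≡* (trans (ℤ.*-identityʳ _) (cong (ℤ.+ suc a ℤ.*_) (cong ℤ.+_ (sym (ℕ.*-identityʳ (suc d)))))) ⟩
    ℚᵘ.mkℚᵘ (ℤ.+ suc a) 0                             ≈⟨ toℚᵘ-toℚ (suc a) ⟨
    toℚᵘ (toℚ (suc a))                                ∎)
    where
    open ℚᵘ.≃-Reasoning
    import Data.Integer.Properties as ℤ
    ε = mkℚ (ℤ.+ suc a) d c

  *-pos : ∀ {p q} → 0ℚ < p → 0ℚ < q → 0ℚ < p * q
  *-pos {p} {q} 0<p 0<q = ℚ.positive⁻¹ (p * q) {{ℚ.pos*pos⇒pos p {{positive 0<p}} q {{positive 0<q}}}}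

  *-monoˡ-≤ : ∀ {r p q} → 0ℚ ≤ r → p ≤ q → r * p ≤ r * q
  *-monoˡ-≤ {r} 0≤r = ℚ.*-monoˡ-≤-nonNeg r {{nonNegative 0≤r}}

  *-monoʳ-≤ : ∀ {r p q} → 0ℚ ≤ r → p ≤ q → p * r ≤ q * r
  *-monoʳ-≤ {r} 0≤r = ℚ.*-monoʳ-≤-nonNeg r {{nonNegative 0≤r}}

  ∣p*q∣≡∣p∣*q : ∀ p {q} → 0ℚ ≤ q → ∣ p * q ∣ ≡ ∣ p ∣ * q
  ∣p*q∣≡∣p∣*q p {q} 0≤q = trans (ℚ.∣p*q∣≡∣p∣*∣q∣ p q) (cong (∣ p ∣ *_) (ℚ.0≤p⇒∣p∣≡p 0≤q))

  ^-distribʳ-* : ∀ k a b → (a * b) ^ k ≡ a ^ k * b ^ k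
  ^-distribʳ-* zero    a b = refl
  ^-distribʳ-* (suc k) a b = trans (cong (a * b *_) (^-distribʳ-* k a b)) (interchange a b (a ^ k) (b ^ k))
    where
    interchange : ∀ a b p q → a * b * (p * q) ≡ a * p * (b * q)
    interchange = solve-∀ ℚ-ring

  1^ : ∀ k → 1 ^ k ≡ 1
  1^ zero    = refl
  1^ (suc k) = trans (ℚ.*-identityˡ (1 ^ k)) (1^ k)

  ^-pos : ∀ k {a} → 0ℚ < a → 0ℚ < a ^ k
  ^-pos zero    0<a = ℚ.positive⁻¹ 1
  ^-pos (suc k) 0<a = *-pos 0<a (^-pos k 0<a)

  1≤^ : ∀ k {a} → 1 ≤ a → 1 ≤ a ^ k
  1≤^ zero    1≤a = ℚ.≤-refl
  1≤^ (suc k) {a} 1≤a = begin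
    1              ≡⟨ ℚ.*-identityˡ 1 ⟨
    1 * 1          ≤⟨ ℚ.*-monoʳ-≤-nonNeg 1 1≤a ⟩
    a * 1          ≤⟨ *-monoˡ-≤ (ℚ.≤-trans (ℚ.nonNegative⁻¹ 1) 1≤a) (1≤^ k 1≤a) ⟩
    a * a ^ k      ∎
    where open ℚ.≤-Reasoning

  ÷′-* : ∀ p {q} → 0ℚ < q → (p ÷′ q) * q ≡ p
  ÷′-* p {q} 0<q with q ℚ.≟ 0ℚ
  ... | yes q≡0 = ⊥-elim (ℚ.<-irrefl (sym q≡0) 0<q)
  ... | no  q≢0 = trans (ℚ.*-assoc p _ q)
    (trans (cong (p *_) (ℚ.*-inverseˡ q {{≢-nonZero q≢0}})) (ℚ.*-identityʳ p))

  0÷′ : ∀ q → 0ℚ ÷′ q ≡ 0ℚ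
  0÷′ q with q ℚ.≟ 0ℚ
  ... | yes _   = refl
  ... | no  q≢0 = ℚ.*-zeroˡ (1/_ q {{≢-nonZero q≢0}})

  sumℚ : List ℚ → ℚ
  sumℚ = foldr _+_ 0ℚ

  sumℚ-↭ : ∀ {xs ys} → xs ↭ ys → sumℚ xs ≡ sumℚ ys
  sumℚ-↭ p = foldr-commMonoid ℚ.+-0-isCommutativeMonoid (↭⇒↭ₛ′ isEquivalence p)

  sumℚ-++ : ∀ xs ys → sumℚ (xs ++ ys) ≡ sumℚ xs + sumℚ ys
  sumℚ-++ []       ys = sym (ℚ.+-identityˡ (sumℚ ys))
  sumℚ-++ (x ∷ xs) ys = trans (cong (x +_) (sumℚ-++ xs ys)) (sym (ℚ.+-assoc x (sumℚ xs) (sumℚ ys)))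

  sumℚ-copies : ∀ k xs → sumℚ (copies k xs) ≡ toℚ k * sumℚ xs
  sumℚ-copies zero    xs = sym (ℚ.*-zeroˡ (sumℚ xs))
  sumℚ-copies (suc k) xs = begin
    sumℚ (xs ++ copies k xs)        ≡⟨ sumℚ-++ xs (copies k xs) ⟩
    sumℚ xs + sumℚ (copies k xs)    ≡⟨ cong (sumℚ xs +_) (sumℚ-copies k xs) ⟩
    sumℚ xs + toℚ k * sumℚ xs       ≡⟨ distrib (toℚ k) (sumℚ xs) ⟩
    (1 + toℚ k) * sumℚ xs           ≡⟨ cong (_* sumℚ xs) (toℚ-suc k) ⟨
    toℚ (suc k) * sumℚ xs           ∎
    where
    open ≡-Reasoning
    distrib : ∀ a s → s + a * s ≡ (1 + a) * s
    distrib = solve-∀ ℚ-ring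

  mean-↭ : ∀ {xs ys} → xs ↭ ys → mean xs ≡ mean ys
  mean-↭ {[]}     {[]}     p = refl
  mean-↭ {[]}     {y ∷ ys} p with () ← ↭-empty-inv (↭-sym p)
  mean-↭ {x ∷ xs} {[]}     p with () ← ↭-empty-inv p
  mean-↭ {x ∷ xs} {y ∷ ys} p = cong₂ (λ s l → s * (ℤ.+ 1 / suc l)) (sumℚ-↭ p) (ℕ.suc-injective (↭-length p))

  mean-copies : ∀ k xs → mean (copies (suc k) xs) ≡ mean xs
  mean-copies k []       = cong mean (copies-[] k)
  mean-copies k (x ∷ xs) = begin
    sumℚ (copies (suc k) (x ∷ xs)) * r′      ≡⟨ cong₂ _*_ (sumℚ-copies (suc k) (x ∷ xs)) (cong (λ l → ℤ.+ 1 / suc l) length≡) ⟩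
    toℚ (suc k) * sumℚ (x ∷ xs) * r          ≡⟨ cancel (toℚ (suc k)) (toℚ (suc ℓ)) (sumℚ (x ∷ xs)) r r₀
                                                  (trans (cong (_* r) (sym (toℚ-* (suc k) (suc ℓ)))) (toℚ-suc-*-inverse l))
                                                  (toℚ-suc-*-inverse ℓ) ⟩
    sumℚ (x ∷ xs) * r₀                       ∎
    where
    open ≡-Reasoning
    ℓ = length xs
    l = ℓ ℕ.+ k ℕ.* suc ℓ
    r′ = ℤ.+ 1 / suc (length (xs ++ copies k (x ∷ xs)))
    r = ℤ.+ 1 / suc l
    r₀ = ℤ.+ 1 / suc ℓ
    length≡ : length (xs ++ copies k (x ∷ xs)) ≡ l
    length≡ = trans (length-++ xs) (cong (ℓ ℕ.+_) (length-copies k (x ∷ xs)))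
    cancel : ∀ a b s r r₀ → (a * b) * r ≡ 1 → b * r₀ ≡ 1 → a * s * r ≡ s * r₀
    cancel a b s r r₀ abr≡1 br₀≡1 = begin
      a * s * r                    ≡⟨ ℚ.*-identityʳ _ ⟨
      a * s * r * 1                ≡⟨ cong (a * s * r *_) br₀≡1 ⟨
      a * s * r * (b * r₀)         ≡⟨ rearrange a b s r r₀ ⟩
      s * r₀ * ((a * b) * r)       ≡⟨ cong (s * r₀ *_) abr≡1 ⟩
      s * r₀ * 1                   ≡⟨ ℚ.*-identityʳ _ ⟩
      s * r₀                       ∎
      where
      rearrange : ∀ a b s r r₀ → a * s * r * (b * r₀) ≡ s * r₀ * ((a * b) * r)
      rearrange = solve-∀ ℚ-ring

  mean-a₁-values : ∀ (h : ℕ → ℚ) n → mean (map h (a₁-values n)) ≡ mean (map h (evens n))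
  mean-a₁-values h n with c , eq ← firstPassages-suc 0 n = begin
    mean (map h (a₁-values n))                 ≡⟨ mean-↭ (map⁺ h (chung-feller n)) ⟩
    mean (map h (copies (catalan n) (evens n)))  ≡⟨ cong mean (map-copies h (catalan n) (evens n)) ⟩
    mean (copies (catalan n) (map h (evens n)))  ≡⟨ cong (λ k → mean (copies k (map h (evens n)))) eq ⟩
    mean (copies (suc c) (map h (evens n)))      ≡⟨ mean-copies c (map h (evens n)) ⟩
    mean (map h (evens n))                     ∎
    where open ≡-Reasoning

  mean-evens : ∀ (h : ℕ → ℚ) n → mean (map h (evens n)) ≡ sumℚ (map h (evens n)) * (ℤ.+ 1 / suc n)
  mean-evens h n = cong (λ l → sumℚ (map h (evens n)) * (ℤ.+ 1 / suc l))
    (trans (length-map h (evensFrom 2 n)) (length-evensFrom 2 n))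

  sumℚ-evens : ∀ n → sumℚ (map toℚ (evens n)) ≡ toℚ n * toℚ (suc n)
  sumℚ-evens zero    = refl
  sumℚ-evens (suc n) = begin
    sumℚ (map toℚ (evens (suc n)))                      ≡⟨ cong (λ xs → sumℚ (map toℚ xs)) (evens-suc n) ⟩
    sumℚ (map toℚ (evens n ++ [ 2 ℕ.* suc n ]))         ≡⟨ cong sumℚ (map-++ toℚ (evens n) [ 2 ℕ.* suc n ]) ⟩
    sumℚ (map toℚ (evens n) ++ [ toℚ (2 ℕ.* suc n) ])   ≡⟨ sumℚ-++ (map toℚ (evens n)) _ ⟩
    sumℚ (map toℚ (evens n)) + (toℚ (2 ℕ.* suc n) + 0ℚ) ≡⟨ cong₂ (λ a b → a + (b + 0ℚ)) (sumℚ-evens n) (toℚ-* 2 (suc n)) ⟩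
    toℚ n * toℚ (suc n) + (2 * toℚ (suc n) + 0ℚ)        ≡⟨ cong (λ a → toℚ n * a + (2 * a + 0ℚ)) (toℚ-suc n) ⟩
    y * (1 + y) + (2 * (1 + y) + 0ℚ)                    ≡⟨ identity y ⟩
    (1 + y) * (1 + (1 + y))                             ≡⟨ cong₂ _*_ (toℚ-suc n) (trans (toℚ-suc (suc n)) (cong (1 +_) (toℚ-suc n))) ⟨
    toℚ (suc n) * toℚ (suc (suc n))                     ∎
    where
    open ≡-Reasoning
    y = toℚ n
    identity : ∀ y → y * (1 + y) + (2 * (1 + y) + 0ℚ) ≡ (1 + y) * (1 + (1 + y))
    identity = solve-∀ ℚ-ring

  Xs≡ : ∀ n → Xs n ≡ map toℚ (a₁-values n)
  Xs≡ n = map-∘ (W n)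

  E≡ : ∀ n → E n ≡ toℚ n
  E≡ n = begin
    mean (Xs n)                          ≡⟨ cong mean (Xs≡ n) ⟩
    mean (map toℚ (a₁-values n))         ≡⟨ mean-a₁-values toℚ n ⟩
    mean (map toℚ (evens n))             ≡⟨ mean-evens toℚ n ⟩
    sumℚ (map toℚ (evens n)) * r         ≡⟨ cong (_* r) (sumℚ-evens n) ⟩
    toℚ n * toℚ (suc n) * r              ≡⟨ ℚ.*-assoc (toℚ n) (toℚ (suc n)) r ⟩
    toℚ n * (toℚ (suc n) * r)            ≡⟨ cong (toℚ n *_) (toℚ-suc-*-inverse n) ⟩
    toℚ n * 1                            ≡⟨ ℚ.*-identityʳ (toℚ n) ⟩
    toℚ n                                ∎
    where
    open ≡-Reasoning
    r = ℤ.+ 1 / suc n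

  powerSum : ℕ → ℕ → ℚ
  powerSum k n = sumℚ (map (λ i → (toℚ i - toℚ n) ^ k) (evens n))

  central≡ : ∀ k n → central k n ≡ powerSum k n * (ℤ.+ 1 / suc n)
  central≡ k n = begin
    mean (map (λ x → (x - E n) ^ k) (Xs n))                       ≡⟨ cong (λ e → mean (map (λ x → (x - e) ^ k) (Xs n))) (E≡ n) ⟩
    mean (map (λ x → (x - toℚ n) ^ k) (Xs n))                     ≡⟨ cong mean (trans (sym (map-∘ (W n))) (map-∘ (W n))) ⟨
    mean (map (λ i → (toℚ i - toℚ n) ^ k) (a₁-values n))          ≡⟨ mean-a₁-values (λ i → (toℚ i - toℚ n) ^ k) n ⟩
    mean (map (λ i → (toℚ i - toℚ n) ^ k) (evens n))              ≡⟨ mean-evens (λ i → (toℚ i - toℚ n) ^ k) n ⟩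
    powerSum k n * (ℤ.+ 1 / suc n)                                ∎
    where open ≡-Reasoning

  powerSum-2+ : ∀ k n → powerSum k (2 ℕ.+ n) ≡ powerSum k n + ((- (toℚ n + 2)) ^ k + (toℚ n + 2) ^ k)
  powerSum-2+ k n = begin
    sumℚ (map f (evens (2 ℕ.+ n)))
      ≡⟨ cong (λ xs → sumℚ (map f xs)) (evens-2+ n) ⟩
    f 0 + sumℚ (map f (map (2 ℕ.+_) (evens n) ++ [ last ]))
      ≡⟨ cong (f 0 +_) (trans (cong sumℚ (map-++ f (map (2 ℕ.+_) (evens n)) [ last ]))
                              (sumℚ-++ (map f (map (2 ℕ.+_) (evens n))) [ f last ])) ⟩
    f 0 + (sumℚ (map f (map (2 ℕ.+_) (evens n))) + (f last + 0ℚ))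
      ≡⟨ cong₂ (λ a b → a + (b + (f last + 0ℚ))) first
               (cong sumℚ (trans (sym (map-∘ {g = f} {f = 2 ℕ.+_} (evens n))) (map-cong middle (evens n)))) ⟩
    (- a) ^ k + (powerSum k n + (f last + 0ℚ))
      ≡⟨ cong (λ b → (- a) ^ k + (powerSum k n + (b + 0ℚ))) final ⟩
    (- a) ^ k + (powerSum k n + (a ^ k + 0ℚ))
      ≡⟨ rearrange ((- a) ^ k) (powerSum k n) (a ^ k) ⟩
    powerSum k n + ((- a) ^ k + a ^ k) ∎
    where
    open ≡-Reasoning
    a = toℚ n + 2
    f : ℕ → ℚ
    f i = (toℚ i - toℚ (2 ℕ.+ n)) ^ k
    last = 2 ℕ.* suc n ℕ.+ 2
    first : f 0 ≡ (- a) ^ k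
    first = trans (cong (λ b → (0ℚ - b) ^ k) (toℚ-2+ n)) (cong (_^ k) (ℚ.+-identityˡ (- a)))
    middle : ∀ i → f (2 ℕ.+ i) ≡ (toℚ i - toℚ n) ^ k
    middle i = cong (_^ k) (trans (cong₂ _-_ (toℚ-2+ i) (toℚ-2+ n)) (cancel (toℚ i) (toℚ n)))
      where
      cancel : ∀ y x → (y + 2) - (x + 2) ≡ y - x
      cancel = solve-∀ ℚ-ring
    toℚ-last : toℚ last ≡ 2 * (1 + toℚ n) + 2
    toℚ-last = trans (toℚ-+ (2 ℕ.* suc n) 2) (cong (_+ 2) (trans (toℚ-* 2 (suc n)) (cong (2 *_) (toℚ-suc n))))
    final : f last ≡ a ^ k
    final = cong (_^ k) (trans (cong₂ _-_ toℚ-last (toℚ-2+ n)) (outer (toℚ n)))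
      where
      outer : ∀ x → (2 * (1 + x) + 2) - (x + 2) ≡ x + 2
      outer = solve-∀ ℚ-ring
    rearrange : ∀ p s q → p + (s + (q + 0ℚ)) ≡ s + (p + q)
    rearrange = solve-∀ ℚ-ring

  powerSum-closed-form : ∀ k (P : ℚ → ℚ) → powerSum k 0 ≡ P 0 → powerSum k 1 ≡ P 1 →
    (∀ x → P (x + 2) ≡ P x + ((- (x + 2)) ^ k + (x + 2) ^ k)) → ∀ n → powerSum k n ≡ P (toℚ n)
  powerSum-closed-form k P p₀ p₁ step zero          = p₀
  powerSum-closed-form k P p₀ p₁ step (suc zero)    = p₁
  powerSum-closed-form k P p₀ p₁ step (suc (suc n)) = begin
    powerSum k (2 ℕ.+ n)       ≡⟨ powerSum-2+ k n ⟩
    powerSum k n + δ           ≡⟨ cong (_+ δ) (powerSum-closed-form k P p₀ p₁ step n) ⟩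
    P (toℚ n) + δ              ≡⟨ step (toℚ n) ⟨
    P (toℚ n + 2)              ≡⟨ cong P (toℚ-2+ n) ⟨
    P (toℚ (2 ℕ.+ n))          ∎
    where
    open ≡-Reasoning
    δ = (- (toℚ n + 2)) ^ k + (toℚ n + 2) ^ k

  neg-^-even : ∀ i a → (- a) ^ (2 ℕ.* i) ≡ a ^ (2 ℕ.* i)
  neg-^-even zero    a = refl
  neg-^-even (suc i) a = begin
    (- a) ^ (2 ℕ.* suc i)                 ≡⟨ cong ((- a) ^_) (double-suc i) ⟩
    - a * (- a * (- a) ^ (2 ℕ.* i))       ≡⟨ cong (λ p → - a * (- a * p)) (neg-^-even i a) ⟩
    - a * (- a * a ^ (2 ℕ.* i))           ≡⟨ neg-square a (a ^ (2 ℕ.* i)) ⟩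
    a * (a * a ^ (2 ℕ.* i))               ≡⟨ cong (a ^_) (double-suc i) ⟨
    a ^ (2 ℕ.* suc i)                     ∎
    where
    open ≡-Reasoning
    double-suc : ∀ i → 2 ℕ.* suc i ≡ 2 ℕ.+ 2 ℕ.* i
    double-suc i = cong suc (ℕ.+-suc i (i ℕ.+ 0))
    neg-square : ∀ a p → - a * (- a * p) ≡ a * (a * p)
    neg-square = solve-∀ ℚ-ring

  neg-^-odd : ∀ i a → (- a) ^ suc (2 ℕ.* i) ≡ - (a ^ suc (2 ℕ.* i))
  neg-^-odd i a = trans (cong (- a *_) (neg-^-even i a)) (sym (ℚ.neg-distribˡ-* a (a ^ (2 ℕ.* i))))

  powerSum-odd≡0 : ∀ i n → powerSum (suc (2 ℕ.* i)) n ≡ 0ℚ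
  powerSum-odd≡0 i = powerSum-closed-form k (λ _ → 0ℚ) (cong (_+ 0ℚ) (ℚ.*-zeroˡ (0ℚ ^ (2 ℕ.* i))))
    (trans (cong (_+ (1 ^ k + 0ℚ)) (neg-^-odd i 1)) (cancel (1 ^ k)))
    (λ x → sym (trans (ℚ.+-identityˡ _) (trans (cong (_+ (x + 2) ^ k) (neg-^-odd i (x + 2))) (ℚ.+-inverseˡ ((x + 2) ^ k)))))
    where
    k = suc (2 ℕ.* i)
    cancel : ∀ p → - p + (p + 0ℚ) ≡ 0ℚ
    cancel = solve-∀ ℚ-ring

  horner : List ℚ → ℚ → ℚ
  horner []       x = 0ℚ
  horner (c ∷ cs) x = c + x * horner cs x

  -- u n = 3 Var(X n): every even central moment is a polynomial in u n.
  u : ℕ → ℚ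
  u n = toℚ n * (toℚ n + 2)

  evenPowerSum : List ℚ → ℚ → ℚ
  evenPowerSum qs x = (x + 1) * horner qs (x * (x + 2))

  EvenPowerSumStep : List ℚ → ℕ → Set
  EvenPowerSumStep qs k = ∀ x → evenPowerSum qs (x + 2) ≡ evenPowerSum qs x + ((- (x + 2)) ^ k + (x + 2) ^ k)

  central-closed-form : ∀ k qs → powerSum k 0 ≡ evenPowerSum qs 0 → powerSum k 1 ≡ evenPowerSum qs 1 →
    EvenPowerSumStep qs k → ∀ n → central k n ≡ horner qs (u n)
  central-closed-form k qs p₀ p₁ step n = begin
    central k n                                   ≡⟨ central≡ k n ⟩
    powerSum k n * r                              ≡⟨ cong (_* r) (powerSum-closed-form k (evenPowerSum qs) p₀ p₁ step n) ⟩
    (toℚ n + 1) * horner qs (u n) * r             ≡⟨ cong (λ a → a * horner qs (u n) * r) (trans (ℚ.+-comm (toℚ n) 1) (sym (toℚ-suc n))) ⟩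
    toℚ (suc n) * horner qs (u n) * r             ≡⟨ swap (toℚ (suc n)) (horner qs (u n)) r ⟩
    horner qs (u n) * (toℚ (suc n) * r)           ≡⟨ cong (horner qs (u n) *_) (toℚ-suc-*-inverse n) ⟩
    horner qs (u n) * 1                           ≡⟨ ℚ.*-identityʳ _ ⟩
    horner qs (u n)                               ∎
    where
    open ≡-Reasoning
    r = ℤ.+ 1 / suc n
    swap : ∀ a h r → a * h * r ≡ h * (a * r)
    swap = solve-∀ ℚ-ring

  -- Q k lists the coefficients in u of the k-th central moment (found by interpolation; the Q-steps verify them).
  Q₂ Q₄ Q₆ Q₈ Q₁₀ : List ℚ
  Q₂  = 0 ∷ 1 / 3 ∷ []
  Q₄  = 0 ∷ - (4 / 15) ∷ 1 / 5 ∷ []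
  Q₆  = 0 ∷ 16 / 21 ∷ - (4 / 7) ∷ 1 / 7 ∷ []
  Q₈  = 0 ∷ - (64 / 15) ∷ 16 / 5 ∷ - (8 / 9) ∷ 1 / 9 ∷ []
  Q₁₀ = 0 ∷ 1280 / 33 ∷ - (320 / 11) ∷ 272 / 33 ∷ - (40 / 33) ∷ 1 / 11 ∷ []

  module _ where
    open import Data.Rational.Solver using (module +-*-Solver)
    open +-*-Solver
    open import Data.Product using (_×_)

    hornerᴾ : List ℚ → Polynomial 1 → Polynomial 1
    hornerᴾ []       x = con 0ℚ
    hornerᴾ (c ∷ cs) x = con c :+ x :* hornerᴾ cs x

    powᴾ : Polynomial 1 → ℕ → Polynomial 1
    powᴾ p zero    = con 1
    powᴾ p (suc k) = p :* powᴾ p k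

    evenPowerSumᴾ : List ℚ → Polynomial 1 → Polynomial 1
    evenPowerSumᴾ qs x = (x :+ con 1) :* hornerᴾ qs (x :* (x :+ con 2))

    evenPowerSumStepᴾ : List ℚ → ℕ → Polynomial 1 → Polynomial 1 × Polynomial 1
    evenPowerSumStepᴾ qs k x = evenPowerSumᴾ qs (x :+ con 2)
      := evenPowerSumᴾ qs x :+ (powᴾ (:- (x :+ con 2)) k :+ powᴾ (x :+ con 2) k)

    Q₂-step : EvenPowerSumStep Q₂ 2
    Q₂-step = solve 1 (evenPowerSumStepᴾ Q₂ 2) (λ {_} → refl)

    Q₄-step : EvenPowerSumStep Q₄ 4
    Q₄-step = solve 1 (evenPowerSumStepᴾ Q₄ 4) (λ {_} → refl)

    Q₆-step : EvenPowerSumStep Q₆ 6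
    Q₆-step = solve 1 (evenPowerSumStepᴾ Q₆ 6) (λ {_} → refl)

    Q₈-step : EvenPowerSumStep Q₈ 8
    Q₈-step = solve 1 (evenPowerSumStepᴾ Q₈ 8) (λ {_} → refl)

    Q₁₀-step : EvenPowerSumStep Q₁₀ 10
    Q₁₀-step = solve 1 (evenPowerSumStepᴾ Q₁₀ 10) (λ {_} → refl)

  central₂ : ∀ n → central 2 n ≡ horner Q₂ (u n)
  central₂ = central-closed-form 2 Q₂ refl refl Q₂-step

  central₄ : ∀ n → central 4 n ≡ horner Q₄ (u n)
  central₄ = central-closed-form 4 Q₄ refl refl Q₄-step

  central₆ : ∀ n → central 6 n ≡ horner Q₆ (u n)
  central₆ = central-closed-form 6 Q₆ refl refl Q₆-step

  central₈ : ∀ n → central 8 n ≡ horner Q₈ (u n)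
  central₈ = central-closed-form 8 Q₈ refl refl Q₈-step

  central₁₀ : ∀ n → central 10 n ≡ horner Q₁₀ (u n)
  central₁₀ = central-closed-form 10 Q₁₀ refl refl Q₁₀-step

  Var≡ : ∀ n → Var n ≡ u n * (1 / 3)
  Var≡ n = trans (central₂ n) (simplify (u n))
    where
    simplify : ∀ x → 0 + x * (1 / 3 + x * 0ℚ) ≡ x * (1 / 3)
    simplify = solve-∀ ℚ-ring

  Var-formula : ∀ n → Var n ≡ toℚ n * toℚ n * (1 / 3) + toℚ n * (2 / 3)
  Var-formula n = trans (Var≡ n) (expand (toℚ n))
    where
    expand : ∀ x → x * (x + 2) * (1 / 3) ≡ x * x * (1 / 3) + x * (2 / 3)
    expand = solve-∀ ℚ-ring

  horner-++ : ∀ xs ys x → horner (xs ++ ys) x ≡ horner xs x + x ^ length xs * horner ys x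
  horner-++ []       ys x = sym (trans (ℚ.+-identityˡ _) (ℚ.*-identityˡ _))
  horner-++ (c ∷ xs) ys x = trans (cong (λ h → c + x * h) (horner-++ xs ys x))
    (distrib c x (horner xs x) (x ^ length xs) (horner ys x))
    where
    distrib : ∀ c x h p y → c + x * (h + p * y) ≡ c + x * h + x * p * y
    distrib = solve-∀ ℚ-ring

  sumAbs : List ℚ → ℚ
  sumAbs cs = sumℚ (map ∣_∣ cs)

  ∣horner∣-bound : ∀ {x} → 1 ≤ x → ∀ cs → ∣ horner cs x ∣ * x ≤ sumAbs cs * x ^ length cs
  ∣horner∣-bound {x} 1≤x []       = ℚ.≤-reflexive (ℚ.*-zeroˡ x)
  ∣horner∣-bound {x} 1≤x (c ∷ cs) = begin
    ∣ c + x * h ∣ * x                         ≤⟨ *-monoʳ-≤ 0≤x (ℚ.∣p+q∣≤∣p∣+∣q∣ c (x * h)) ⟩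
    (∣ c ∣ + ∣ x * h ∣) * x                   ≡⟨ cong (λ a → (∣ c ∣ + a) * x) (trans (cong ∣_∣ (ℚ.*-comm x h)) (∣p*q∣≡∣p∣*q h 0≤x)) ⟩
    (∣ c ∣ + ∣ h ∣ * x) * x                   ≡⟨ distrib ∣ c ∣ ∣ h ∣ x ⟩
    ∣ c ∣ * x + x * (∣ h ∣ * x)               ≤⟨ ℚ.+-mono-≤ (*-monoˡ-≤ (ℚ.0≤∣p∣ c) x≤x^) (*-monoˡ-≤ 0≤x (∣horner∣-bound 1≤x cs)) ⟩
    ∣ c ∣ * x ^ suc l + x * (sumAbs cs * x ^ l) ≡⟨ collect ∣ c ∣ (sumAbs cs) x (x ^ l) ⟩
    (∣ c ∣ + sumAbs cs) * x ^ suc l            ∎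
    where
    open ℚ.≤-Reasoning
    h = horner cs x
    l = length cs
    0≤x : 0ℚ ≤ x
    0≤x = ℚ.≤-trans (ℚ.nonNegative⁻¹ 1) 1≤x
    x≤x^ : x ≤ x ^ suc l
    x≤x^ = subst (_≤ x ^ suc l) (ℚ.*-identityʳ x) (*-monoˡ-≤ 0≤x (1≤^ l 1≤x))
    distrib : ∀ a b x → (a + b * x) * x ≡ a * x + x * (b * x)
    distrib = solve-∀ ℚ-ring
    collect : ∀ a s x p → a * (x * p) + x * (s * p) ≡ (a + s) * (x * p)
    collect = solve-∀ ℚ-ring

  u≡toℚ : ∀ n → u n ≡ toℚ (n ℕ.* (2 ℕ.+ n))
  u≡toℚ n = sym (trans (toℚ-* n (2 ℕ.+ n)) (cong (toℚ n *_) (toℚ-2+ n)))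

  toℚ-≤-u : ∀ n → toℚ n ≤ u n
  toℚ-≤-u n = subst (toℚ n ≤_) (sym (u≡toℚ n)) (toℚ-mono-≤ (ℕ.m≤m*n n (2 ℕ.+ n)))

  1≤u : ∀ m → 1 ≤ u (suc m)
  1≤u m = ℚ.≤-trans (toℚ-mono-≤ {1} {suc m} (s≤s ℕ.z≤n)) (toℚ-≤-u (suc m))

  0<u : ∀ m → 0ℚ < u (suc m)
  0<u m = ℚ.<-≤-trans (ℚ.positive⁻¹ 1) (1≤u m)

  -- ε = (a + 1)/(d + 1) and N + 1 = (d + 1)(K + 1) give ε (N + 1) = (a + 1)(K + 1) > K.
  archimedean : ∀ K ε → 0ℚ < ε → ∃ λ N → toℚ K < ε * toℚ (suc N)
  archimedean K ε@(mkℚ (ℤ.+ suc a) d c) 0<ε = K ℕ.+ d ℕ.* suc K , (begin-strict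
    toℚ K                             <⟨ toℚ-<-suc K ⟩
    toℚ (suc K)                       ≤⟨ toℚ-mono-≤ (ℕ.m≤n*m (suc K) (suc a)) ⟩
    toℚ (suc a ℕ.* suc K)             ≡⟨ toℚ-* (suc a) (suc K) ⟩
    toℚ (suc a) * toℚ (suc K)         ≡⟨ cong (_* toℚ (suc K)) (mkℚ-*-toℚ-denominator a d c) ⟨
    ε * toℚ (suc d) * toℚ (suc K)     ≡⟨ ℚ.*-assoc ε (toℚ (suc d)) (toℚ (suc K)) ⟩
    ε * (toℚ (suc d) * toℚ (suc K))   ≡⟨ cong (ε *_) (toℚ-* (suc d) (suc K)) ⟨
    ε * toℚ (suc d ℕ.* suc K)         ∎)
    where
    open ℚ.≤-Reasoning
  archimedean K (mkℚ (ℤ.+ zero) d c) (*<* (ℤ.+<+ ()))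
  archimedean K (mkℚ -[1+ n ] d c)   (*<* ())

  ⟶-of-bound : ∀ (f : ℕ → ℚ) L K → (∀ m → ∣ f (suc m) - L ∣ * toℚ (suc m) ≤ toℚ K) → f ⟶ L
  ⟶-of-bound f L K bound ε 0<ε with N , K<εN ← archimedean K ε 0<ε = suc N , close
    where
    close : ∀ n → suc N ℕ.≤ n → ∣ f n - L ∣ < ε
    close (suc m) (s≤s N≤m) = ℚ.*-cancelʳ-<-nonNeg (toℚ (suc m)) {{ℚ.normalize-nonNeg (suc m) 1}} (begin-strict
      ∣ f (suc m) - L ∣ * toℚ (suc m)   ≤⟨ bound m ⟩
      toℚ K                             <⟨ K<εN ⟩
      ε * toℚ (suc N)                   ≤⟨ *-monoˡ-≤ (ℚ.<⇒≤ 0<ε) (toℚ-mono-≤ (s≤s N≤m)) ⟩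
      ε * toℚ (suc m)                   ∎)
      where open ℚ.≤-Reasoning

  ≤-by-decision : ∀ {p q} {p≤q : True (p ℚ.≤? q)} → p ≤ q
  ≤-by-decision {p≤q = p≤q} = toWitness p≤q

  μ-even-*-u^ : ∀ j m → μ-even j (suc m) * u (suc m) ^ j ≡ central (2 ℕ.* j) (suc m) * 3 ^ j
  μ-even-*-u^ j m = begin
    μ * U ^ j                               ≡⟨ ℚ.*-identityʳ (μ * U ^ j) ⟨
    μ * U ^ j * 1                           ≡⟨ cong (μ * U ^ j *_) third^j*3^j ⟨
    μ * U ^ j * ((1 / 3) ^ j * 3 ^ j)       ≡⟨ regroup μ (U ^ j) ((1 / 3) ^ j) (3 ^ j) ⟩
    μ * (U ^ j * (1 / 3) ^ j) * 3 ^ j       ≡⟨ cong (λ v → μ * v * 3 ^ j) Var^j ⟨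
    μ * Var n ^ j * 3 ^ j                   ≡⟨ cong (_* 3 ^ j) (÷′-* (central (2 ℕ.* j) n) (^-pos j 0<Var)) ⟩
    central (2 ℕ.* j) n * 3 ^ j             ∎
    where
    open ≡-Reasoning
    n = suc m
    μ = μ-even j n
    U = u n
    third^j*3^j : (1 / 3) ^ j * 3 ^ j ≡ 1
    third^j*3^j = trans (sym (^-distribʳ-* j (1 / 3) 3)) (1^ j)
    Var^j : Var n ^ j ≡ U ^ j * (1 / 3) ^ j
    Var^j = trans (cong (_^ j) (Var≡ n)) (^-distribʳ-* j U (1 / 3))
    0<Var : 0ℚ < Var n
    0<Var = subst (0ℚ <_) (sym (Var≡ n)) (*-pos (0<u m) (ℚ.positive⁻¹ (1 / 3)))
    regroup : ∀ μ p q t → μ * p * (q * t) ≡ μ * (p * q) * t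
    regroup = solve-∀ ℚ-ring

  μ-even-error : ∀ rs c m → central (2 ℕ.* suc (length rs)) (suc m) ≡ horner (0 ∷ rs ++ [ c ]) (u (suc m)) →
    (μ-even (suc (length rs)) (suc m) - 3 ^ suc (length rs) * c) * u (suc m) ^ suc (length rs)
      ≡ 3 ^ suc (length rs) * (u (suc m) * horner rs (u (suc m)))
  μ-even-error rs c m closed = begin
    (μ - T * c) * U ^ j                                  ≡⟨ distrib μ (T * c) (U ^ j) ⟩
    μ * U ^ j - T * c * U ^ j                            ≡⟨ cong (_- T * c * U ^ j) (μ-even-*-u^ j m) ⟩
    central (2 ℕ.* j) n * T - T * c * U ^ j              ≡⟨ cong (λ e → e * T - T * c * U ^ j) (trans closed (cong (λ e → 0 + U * e) (horner-++ rs [ c ] U))) ⟩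
    (0 + U * (R + U ^ i * (c + U * 0ℚ))) * T - T * c * (U * U ^ i) ≡⟨ cancel U (U ^ i) R c T ⟩
    T * (U * R)                                          ∎
    where
    open ≡-Reasoning
    i = length rs
    j = suc i
    n = suc m
    μ = μ-even j n
    U = u n
    R = horner rs U
    T = 3 ^ j
    distrib : ∀ μ l p → (μ - l) * p ≡ μ * p - l * p
    distrib = solve-∀ ℚ-ring
    cancel : ∀ U P R c T → (0 + U * (R + P * (c + U * 0ℚ))) * T - T * c * (U * P) ≡ T * (U * R)
    cancel = solve-∀ ℚ-ring

  -- By μ-even-error, ∣μ₂ⱼ - 3ʲ c∣ uʲ = 3ʲ u ∣rs(u)∣ ≤ 3ʲ (Σ ∣rs∣) uʲ⁻¹; then use n ≤ u.
  μ-even⟶ : ∀ rs c N → 3 ^ suc (length rs) * sumAbs rs ≤ toℚ N →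
    (∀ n → central (2 ℕ.* suc (length rs)) n ≡ horner (0 ∷ rs ++ [ c ]) (u n)) →
    μ-even (suc (length rs)) ⟶ (3 ^ suc (length rs) * c)
  μ-even⟶ rs c N TK≤N closed = ⟶-of-bound (μ-even j) (T * c) N bound
    where
    i = length rs
    j = suc i
    T = 3 ^ j
    0≤T : 0ℚ ≤ T
    0≤T = ℚ.<⇒≤ (^-pos j (ℚ.positive⁻¹ 3))
    bound : ∀ m → ∣ μ-even j (suc m) - T * c ∣ * toℚ (suc m) ≤ toℚ N
    bound m = begin
      ∣ e ∣ * toℚ (suc m)       ≤⟨ *-monoˡ-≤ (ℚ.0≤∣p∣ e) (toℚ-≤-u (suc m)) ⟩
      ∣ e ∣ * U                 ≤⟨ ℚ.*-cancelʳ-≤-pos P {{positive (^-pos i (0<u m))}} scaled ⟩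
      T * sumAbs rs             ≤⟨ TK≤N ⟩
      toℚ N                     ∎
      where
      open ℚ.≤-Reasoning
      e = μ-even j (suc m) - T * c
      U = u (suc m)
      P = U ^ i
      R = horner rs U
      0≤U : 0ℚ ≤ U
      0≤U = ℚ.<⇒≤ (0<u m)
      scaled : ∣ e ∣ * U * P ≤ T * sumAbs rs * P
      scaled = begin
        ∣ e ∣ * U * P             ≡⟨ ℚ.*-assoc ∣ e ∣ U P ⟩
        ∣ e ∣ * U ^ j             ≡⟨ ∣p*q∣≡∣p∣*q e (ℚ.<⇒≤ (^-pos j (0<u m))) ⟨
        ∣ e * U ^ j ∣             ≡⟨ cong ∣_∣ (trans (μ-even-error rs c m (closed (suc m))) (swap T U R)) ⟩
        ∣ R * U * T ∣             ≡⟨ trans (∣p*q∣≡∣p∣*q (R * U) 0≤T) (cong (_* T) (∣p*q∣≡∣p∣*q R 0≤U)) ⟩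
        ∣ R ∣ * U * T             ≤⟨ *-monoʳ-≤ 0≤T (∣horner∣-bound (1≤u m) rs) ⟩
        sumAbs rs * P * T         ≡⟨ rotate (sumAbs rs) P T ⟩
        T * sumAbs rs * P         ∎
        where
        swap : ∀ t u r → t * (u * r) ≡ r * u * t
        swap = solve-∀ ℚ-ring
        rotate : ∀ k p t → k * p * t ≡ t * k * p
        rotate = solve-∀ ℚ-ring

  μ²-odd⟶0 : ∀ i → μ² (suc (2 ℕ.* i)) ⟶ 0ℚ
  μ²-odd⟶0 i ε 0<ε = 0 , λ n _ → subst (λ x → ∣ x - 0ℚ ∣ < ε) (sym (μ²≡0 n)) 0<ε
    where
    k = suc (2 ℕ.* i)
    μ²≡0 : ∀ n → μ² k n ≡ 0ℚ
    μ²≡0 n = trans (cong (λ x → (x ^ 2) ÷′ (Var n ^ k)) central≡0) (0÷′ (Var n ^ k))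
      where
      central≡0 : central k n ≡ 0ℚ
      central≡0 = trans (central≡ k n) (trans (cong (_* (ℤ.+ 1 / suc n)) (powerSum-odd≡0 i n)) (ℚ.*-zeroˡ (ℤ.+ 1 / suc n)))

  μ₄⟶ : μ-even 2 ⟶ (9 / 5)
  μ₄⟶ = μ-even⟶ (- (4 / 15) ∷ []) (1 / 5) 3 ≤-by-decision central₄

  μ₆⟶ : μ-even 3 ⟶ (27 / 7)
  μ₆⟶ = μ-even⟶ (16 / 21 ∷ - (4 / 7) ∷ []) (1 / 7) 36 ≤-by-decision central₆

  μ₈⟶ : μ-even 4 ⟶ (9 / 1)
  μ₈⟶ = μ-even⟶ (- (64 / 15) ∷ 16 / 5 ∷ - (8 / 9) ∷ []) (1 / 9) 677 ≤-by-decision central₈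

  μ₁₀⟶ : μ-even 5 ⟶ (243 / 11)
  μ₁₀⟶ = μ-even⟶ (1280 / 33 ∷ - (320 / 11) ∷ 272 / 33 ∷ - (40 / 33) ∷ []) (1 / 11) 18792 ≤-by-decision central₁₀

open import Defs
open import Data.Nat using (ℕ; _≤_)
open import Data.Integer using (+_)
open import Data.Rational using (ℚ; 0ℚ; _/_; _+_; _*_)
open import Data.Product using (_×_; _,_)
open import Relation.Binary.PropositionalEquality using (_≡_)
open Moments using (E≡; Var-formula; μ²-odd⟶0; μ₄⟶; μ₆⟶; μ₈⟶; μ₁₀⟶)

proposition2p1 : (∀ (n : ℕ) → 1 ≤ n → E n ≡ toℚ n)
    × (∀ (n : ℕ) → 1 ≤ n → Var n ≡ toℚ n * toℚ n * ((+ 1) / 3) + toℚ n * ((+ 2) / 3))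
    × (μ² 3 ⟶ 0ℚ)
    × (μ-even 2 ⟶ ((+ 9) / 5))
    × (μ² 5 ⟶ 0ℚ)
    × (μ-even 3 ⟶ ((+ 27) / 7))
    × (μ² 7 ⟶ 0ℚ)
    × (μ-even 4 ⟶ ((+ 9) / 1))
    × (μ² 9 ⟶ 0ℚ)
    × (μ-even 5 ⟶ ((+ 243) / 11))
proposition2p1 =
  (λ n _ → E≡ n) , (λ n _ → Var-formula n) ,
  μ²-odd⟶0 1 , μ₄⟶ , μ²-odd⟶0 2 , μ₆⟶ , μ²-odd⟶0 3 , μ₈⟶ , μ²-odd⟶0 4 , μ₁₀⟶
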